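{- Let $R$ be a finite set of finitary rule instances and let $\Phi=(\Phi_{\mathsf A},\Phi_{\overline{\mathsf A}},\Phi_{\mathsf R},\Phi_{\overline{\mathsf R}})$ be a B-sequent. Then the procedure $\mathrm{Expand}((\Phi_{\mathsf A},\Phi_{\mathsf R}),(\Phi_{\overline{\mathsf A}},\Phi_{\overline{\mathsf R}}),R)$ always terminates, and it returns a tree that is $(\Phi_{\overline{\mathsf A}},\Phi_{\overline{\mathsf R}})$-closed if and only if $\Phi$ is $R$-provable.
   Context: Formulas are those of a propositional language. A B-sequent is a quadruple $\Phi=(\Phi_{\mathsf A},\Phi_{\overline{\mathsf A}},\Phi_{\mathsf R},\Phi_{\overline{\mathsf R}})$ of finite sets of formulas. A rule instance has an antecedent $(\Delta_{\mathsf A},\Delta_{\mathsf R})$ and a succedent $(\Delta_{\overline{\mathsf A}},\Delta_{\overline{\mathsf R}})$, pairs of sets of formulas; it is finitary if all four sets are finite. It is applicable to a pair $(\Gamma_{\mathsf A},\Gamma_{\mathsf R})$ if $\Delta_{\mathsf A}\subseteq\Gamma_{\mathsf A}$ and $\Delta_{\mathsf R}\subseteq\Gamma_{\mathsf R}$. Trees are rooted trees in which every branch ends in a leaf, nodes labelled by pairs $(\Gamma_{\mathsf A},\Gamma_{\mathsf R})$ of sets of formulas or by $\star$. An $R$-derivation is such a tree in which every non-leaf node labelled $(\Gamma_{\mathsf A},\Gamma_{\mathsf R})$ is expanded by an instance in $R$ applicable to its label: if $\Delta_{\overline{\mathsf A}}\cup\Delta_{\overline{\mathsf R}}=\emptyset$,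 the node has exactly one child, labelled $\star$; otherwise its children are exactly the nodes labelled $(\Gamma_{\mathsf A}\cup\{\psi\},\Gamma_{\mathsf R})$ for $\psi\in\Delta_{\overline{\mathsf A}}$ and $(\Gamma_{\mathsf A},\Gamma_{\mathsf R}\cup\{\psi\})$ for $\psi\in\Delta_{\overline{\mathsf R}}$. Given $C=(\Phi_{\overline{\mathsf A}},\Phi_{\overline{\mathsf R}})$, a node is $C$-closed if it is labelled $\star$ or its label $(\Gamma_{\mathsf A},\Gamma_{\mathsf R})$ satisfies $\Gamma_{\mathsf A}\cap\Phi_{\overline{\mathsf A}}\ne\emptyset$ or $\Gamma_{\mathsf R}\cap\Phi_{\overline{\mathsf R}}\ne\emptyset$; a tree is $C$-closed if all its leaves are. $\Phi$ is $R$-provable if there is an $R$-derivation whose root label $(\Gamma_{\mathsf A},\Gamma_{\mathsf R})$ satisfies $\Gamma_{\mathsf A}\subseteq\Phi_{\mathsf A}$, $\Gamma_{\mathsf R}\subseteq\Phi_{\mathsf R}$ and which is $(\Phi_{\overline{\mathsf A}},\Phi_{\overline{\mathsf R}})$-closed. Procedure $\mathrm{Expand}(F,C,R)$ with $F=(\Gamma_{\mathsf A},\Gamma_{\mathsf R})$, $C=(\Phi_{\overline{\mathsf A}},\Phi_{\overline{\mathsf R}})$: (1) let $T$ be the one-node tree labelled $F$; (2) if $\Gamma_{\mathsf A}\cap\Phi_{\overline{\mathsf A}}\ne\emptyset$ or $\Gamma_{\mathsf R}\cap\Phi_{\overline{\mathsf R}}\ne\emptyset$, return $T$; (3) for each instance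 $r\in R$ (in arbitrary order), with antecedent $(\Delta_{\mathsf A},\Delta_{\mathsf R})$ and succedent $(\Delta_{\overline{\mathsf A}},\Delta_{\overline{\mathsf R}})$: if $\Delta_{\mathsf A}\subseteq\Gamma_{\mathsf A}$, $\Delta_{\mathsf R}\subseteq\Gamma_{\mathsf R}$, $\Delta_{\overline{\mathsf A}}\cap\Gamma_{\mathsf A}=\emptyset$ and $\Delta_{\overline{\mathsf R}}\cap\Gamma_{\mathsf R}=\emptyset$, then (a) if $\Delta_{\overline{\mathsf A}}\cup\Delta_{\overline{\mathsf R}}=\emptyset$, return $T$ with a single child labelled $\star$; (b) for each $\psi\in\Delta_{\overline{\mathsf A}}$ (with new pair $(\Gamma_{\mathsf A}\cup\{\psi\},\Gamma_{\mathsf R})$) and each $\psi\in\Delta_{\overline{\mathsf R}}$ (with new pair $(\Gamma_{\mathsf A},\Gamma_{\mathsf R}\cup\{\psi\})$), in arbitrary order: let $T'=\mathrm{Expand}(\text{new pair},C,R\setminus\{r\})$, add the root of $T'$ (with its subtree) as a child of the root of $T$, and if $T'$ is not $C$-closed, return $T$; (c) if $T$ is $C$-closed, return $T$; (4) return $T$. -}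

module Defs where

open import Data.Nat using (ℕ; zero; suc)
open import Data.Fin using (Fin)
open import Data.Vec using (Vec; lookup; removeAt)
open import Data.List using (List; []; _∷_; _++_; map; allFin)
open import Data.List.Membership.Propositional using (_∈_; _∉_)
open import Data.List.Relation.Binary.Subset.Propositional using (_⊆_)
open import Data.List.Relation.Unary.All using (All)
open import Data.List.Relation.Unary.Any using (Any)
import Data.List.Relation.Unary.All as All
import Data.List.Relation.Unary.Any as Any
open import Data.List.Relation.Binary.Permutation.Propositional using (_↭_)
import Data.List.Membership.DecPropositional as DecMem
import Data.List.Relation.Binary.Subset.DecPropositional as DecSub
import Data.Vec.Membership.Propositional as VecMem
open import Data.Product using (Σ; Σ-syntax; _×_; _,_; proj₁; proj₂)
open import Data.Sum using (_⊎_; inj₁; inj₂)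
open import Data.Unit using (⊤; tt)
open import Data.Empty using (⊥)
open import Relation.Nullary using (Dec; yes; no; ¬_)
open import Relation.Nullary.Decidable using (_×-dec_; _⊎-dec_; ¬?)
open import Relation.Binary.Definitions using (DecidableEquality)
open import Relation.Binary.PropositionalEquality using (_≡_)

-- Finite sets of formulas are represented by lists (membership _∈_).

module _ {Fml : Set} where

  record BSequent : Set where
    constructor bseq
    field
      ΦA  : List Fml
      ΦA̅ : List Fml
      ΦR  : List Fml
      ΦR̅ : List Fml

  Pair : Set
  Pair = List Fml × List Fml

  Cond : Set
  Cond = List Fml × List Fml

  _≋_ : List Fml → List Fml → Set
  xs ≋ ys = (xs ⊆ ys) × (ys ⊆ xs)

  _≈P_ : Pair → Pair → Set
  (a , r) ≈P (a' , r') = (a ≋ a') × (r ≋ r')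

  record Rule : Set where
    constructor rule
    field
      antA : List Fml
      antR : List Fml
      sucA : List Fml
      sucR : List Fml
  open Rule public

  SameRule : Rule → Rule → Set
  SameRule r s =
    (antA r ≋ antA s) × (antR r ≋ antR s) × (sucA r ≋ sucA s) × (sucR r ≋ sucR s)

  Applicable : Rule → Pair → Set
  Applicable r (ΓA , ΓR) = (antA r ⊆ ΓA) × (antR r ⊆ ΓR)

  data Side : Set where
    sA sR : Side

  Child : Set
  Child = Side × Fml

  children : Rule → List Child
  children r = map (sA ,_) (sucA r) ++ map (sR ,_) (sucR r)

  extend : Pair → Child → Pair
  extend (ΓA , ΓR) (sA , ψ) = (ψ ∷ ΓA , ΓR)
  extend (ΓA , ΓR) (sR , ψ) = (ΓA , ψ ∷ ΓR)

  data Tree : Set where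
    star : Tree
    node : Pair → List Tree → Tree

  LabelClosed : Cond → Pair → Set
  LabelClosed (ΦA̅ , ΦR̅) (ΓA , ΓR) = Any (_∈ ΦA̅) ΓA ⊎ Any (_∈ ΦR̅) ΓR

  mutual
    Closed : Cond → Tree → Set
    Closed C star               = ⊤
    Closed C (node F [])        = LabelClosed C F
    Closed C (node F (t ∷ ts))  = AllClosed C (t ∷ ts)

    AllClosed : Cond → List Tree → Set
    AllClosed C []       = ⊤
    AllClosed C (t ∷ ts) = Closed C t × AllClosed C ts

  HasLabel : Tree → Pair → Set
  HasLabel star         G = ⊥
  HasLabel (node G' _)  G = G' ≈P G

  module _ {n : ℕ} (R : Vec Rule n) where
    open VecMem renaming (_∈_ to _∈ᵥ_)

    data Deriv : Tree → Set where
      leaf  : (F : Pair) → Deriv (node F [])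
      axiom : (F : Pair) (r : Rule) → r ∈ᵥ R → Applicable r F →
              children r ≡ [] → Deriv (node F (star ∷ []))
      step  : (F : Pair) (r : Rule) (ts : List Tree) → r ∈ᵥ R → Applicable r F →
              (∀ {t} → t ∈ ts → Σ[ c ∈ Child ] (c ∈ children r × HasLabel t (extend F c))) →
              (∀ {c} → c ∈ children r → Σ[ t ∈ Tree ] (t ∈ ts × HasLabel t (extend F c))) →
              All Deriv ts → Deriv (node F ts)

  rootPair : BSequent → Pair
  rootPair Φ = BSequent.ΦA Φ , BSequent.ΦR Φ

  cond : BSequent → Cond
  cond Φ = BSequent.ΦA̅ Φ , BSequent.ΦR̅ Φ

  RootBelow : BSequent → Tree → Set
  RootBelow Φ star              = ⊥
  RootBelow Φ (node (ΓA , ΓR) _) = (ΓA ⊆ BSequent.ΦA Φ) × (ΓR ⊆ BSequent.ΦR Φ)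

  Provable : {n : ℕ} → Vec Rule n → BSequent → Set
  Provable R Φ = Σ[ T ∈ Tree ] (Deriv R T × RootBelow Φ T × Closed (cond Φ) T)

  -- The "arbitrary order" choices are supplied by
  -- an arbitrary scheduler: at every call it fixes the order in which the
  -- (remaining) rule instances are tried, and for every rule the order in
  -- which the new pairs are expanded.

  record Schedule : Set where
    field
      ruleOrder       : ∀ {n} → Pair → Vec Rule n → List (Fin n)
      ruleOrder-perm  : ∀ {n} (F : Pair) (R : Vec Rule n) → ruleOrder F R ↭ allFin n
      childOrder      : Pair → Rule → List Child
      childOrder-perm : (F : Pair) (r : Rule) → childOrder F r ↭ children r

  module _ (_≟_ : DecidableEquality Fml) where
    open DecMem _≟_ using (_∈?_)
    open DecSub _≟_ using (_⊆?_)

    labelClosed? : (C : Cond) (F : Pair) → Dec (LabelClosed C F)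
    labelClosed? (ΦA̅ , ΦR̅) (ΓA , ΓR) =
      Any.any? (_∈? ΦA̅) ΓA ⊎-dec Any.any? (_∈? ΦR̅) ΓR

    mutual
      closed? : (C : Cond) (t : Tree) → Dec (Closed C t)
      closed? C star              = yes tt
      closed? C (node F [])       = labelClosed? C F
      closed? C (node F (t ∷ ts)) = allClosed? C (t ∷ ts)

      allClosed? : (C : Cond) (ts : List Tree) → Dec (AllClosed C ts)
      allClosed? C []       = yes tt
      allClosed? C (t ∷ ts) = closed? C t ×-dec allClosed? C ts

    Usable : Rule → Pair → Set
    Usable r (ΓA , ΓR) =
      (antA r ⊆ ΓA) × (antR r ⊆ ΓR) × All (_∉ ΓA) (sucA r) × All (_∉ ΓR) (sucR r)

    usable? : (r : Rule) (F : Pair) → Dec (Usable r F)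
    usable? r (ΓA , ΓR) =
      (antA r ⊆? ΓA) ×-dec (antR r ⊆? ΓR)
        ×-dec All.all? (λ ψ → ¬? (ψ ∈? ΓA)) (sucA r)
        ×-dec All.all? (λ ψ → ¬? (ψ ∈? ΓR)) (sucR r)

    module Run (S : Schedule) (C : Cond) where
      open Schedule S

      -- step (3b), for the rule r = R[i]; sub F' = Expand(F', C, R ∖ {r}).
      -- inj₁ T = "return T";  inj₂ acc = continue, acc = children of T so far
      loopChildren : (Pair → Tree) → Pair → List Child → List Tree → Tree ⊎ List Tree
      loopChildren sub F []       acc = inj₂ acc
      loopChildren sub F (c ∷ cs) acc with closed? C (sub (extend F c))
      ... | no  _ = inj₁ (node F (acc ++ sub (extend F c) ∷ []))
      ... | yes _ = loopChildren sub F cs (acc ++ sub (extend F c) ∷ [])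

      -- step (3): loop over the rules R[i] in the given order;
      -- sub i F' = Expand(F', C, R ∖ {R[i]});  acc = current children of T
      loopRules : {n : ℕ} → (Fin n → Pair → Tree) → Vec Rule n → Pair →
                  List (Fin n) → List Tree → Tree
      loopRules sub R F []       acc = node F acc
      loopRules sub R F (i ∷ is) acc with usable? (lookup R i) F
      ... | no  _ = loopRules sub R F is acc
      ... | yes _ with childOrder F (lookup R i)
      ...   | [] = node F (acc ++ star ∷ [])
      ...   | c ∷ cs with loopChildren (sub i) F (c ∷ cs) acc
      ...     | inj₁ T   = T
      ...     | inj₂ acc' with closed? C (node F acc')
      ...       | yes _ = node F acc'
      ...       | no  _ = loopRules sub R F is acc'

      expandWith : {n : ℕ} → (Fin n → Pair → Tree) → Vec Rule n → Pair → Tree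
      expandWith sub R F with labelClosed? C F
      ... | yes _ = node F []
      ... | no  _ = loopRules sub R F (ruleOrder F R) []

      expand : (n : ℕ) → Vec Rule n → Pair → Tree
      expand zero    R F = expandWith (λ ()) R F
      expand (suc m) R F = expandWith (λ i → expand m (removeAt R i)) R F

  Expand : DecidableEquality Fml → Schedule → {n : ℕ} → Vec Rule n → BSequent → Tree
  Expand _≟_ S {n} R Φ = Run.expand _≟_ S (cond Φ) n R (rootPair Φ)

{-# OPTIONS --safe #-}
-- Expand terminates because every recursive call has one rule instance
-- fewer.  Closed derivations are captured by the inductive predicate Closable,
-- and a closed result of Expand is such a derivation (soundness).
-- Hence each recursive call Expand(F ∪ {ψ}, C, R ∖ {r}) closes by induction.
-- (2) A pair that is not closed but has a closed derivation admits a usable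
-- rule: a rule of the derivation whose new formulas are all present already
-- can be bypassed by following one of its branches.
module Submission where

open import Defs
open import Data.Nat using (ℕ; zero; suc)
open import Data.Fin using (Fin; zero; suc; punchOut) renaming (_≟_ to _≟ᶠ_)
open import Data.Vec using (Vec; lookup; removeAt; _∷_)
open import Data.Vec.Properties using (removeAt-punchOut)
open import Data.Vec.Membership.Propositional using () renaming (_∈_ to _∈ᵥ_)
open import Data.Vec.Membership.Propositional.Properties using (∈-lookup)
import Data.Vec.Relation.Unary.Any as VecAny
open import Data.Vec.Relation.Unary.Any.Properties using (lookup-index)
open import Data.List using (List; []; _∷_; _++_; map)
open import Data.List.Properties using (++-identityʳ; ++-assoc)
open import Data.List.Membership.Propositional using (_∈_; _∉_; find)
open import Data.List.Relation.Binary.Subset.Propositional using (_⊆_)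
open import Data.List.Membership.Propositional.Properties using (∈-allFin)
open import Data.List.Relation.Binary.Subset.Propositional.Properties
  using (⊆-refl; Any-resp-⊆; xs⊆x∷xs; ∷⁺ʳ; ∈-∷⁺ʳ)
open import Data.List.Relation.Binary.Permutation.Propositional using (↭-sym)
open import Data.List.Relation.Binary.Permutation.Propositional.Properties
  using (∈-resp-↭; All-resp-↭)
open import Data.List.Relation.Unary.All using (All; []; _∷_)
import Data.List.Relation.Unary.All as All
open import Data.List.Relation.Unary.All.Properties using (¬All⇒Any¬; ++⁻ʳ)
import Data.List.Relation.Unary.All.Properties as Allₚ
open import Data.List.Relation.Unary.Any using (Any; here; there)
import Data.List.Relation.Unary.Any as Any
open import Data.List.Relation.Unary.Any.Properties using (¬Any[]; ++⁺ˡ; ++⁺ʳ)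
import Data.List.Relation.Unary.Any.Properties as Anyₚ
import Data.List.Membership.DecPropositional as DecMembership
open import Data.Product using (Σ-syntax; _×_; _,_; proj₁; proj₂; map₁; map₂)
open import Data.Sum using (inj₁; inj₂)
open import Data.Unit using (tt)
open import Data.Empty using (⊥-elim)
open import Function using (_∘_)
open import Function.Bundles using (_⇔_; mk⇔; module Equivalence)
open import Relation.Binary.Definitions using (DecidableEquality)
open import Relation.Binary.PropositionalEquality
  using (_≡_; _≢_; refl; sym; trans; subst)
open import Relation.Nullary using (yes; no; ¬_)
open import Relation.Nullary.Decidable using (¬?; decidable-stable)

module _ {a} {A : Set a} where

  ∈-removeAt⁻ : ∀ {n} (xs : Vec A (suc n)) i {x} → x ∈ᵥ removeAt xs i → x ∈ᵥ xs
  ∈-removeAt⁻ (_ ∷ _)      zero    x∈               = VecAny.there x∈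
  ∈-removeAt⁻ (_ ∷ _ ∷ _)  (suc i) (VecAny.here x≡)  = VecAny.here x≡
  ∈-removeAt⁻ (_ ∷ y ∷ xs) (suc i) (VecAny.there x∈) =
    VecAny.there (∈-removeAt⁻ (y ∷ xs) i x∈)

  ∈-removeAt⁺ : ∀ {n} {xs : Vec A (suc n)} {x} (x∈ : x ∈ᵥ xs) {i} →
                i ≢ VecAny.index x∈ → x ∈ᵥ removeAt xs i
  ∈-removeAt⁺ {xs = xs} x∈ {i} i≢ =
    subst (_∈ᵥ removeAt xs i)
          (trans (removeAt-punchOut xs i≢) (sym (lookup-index x∈)))
          (∈-lookup (punchOut i≢) (removeAt xs i))

module _ {Fml : Set} where

  infix 4 _⊆P_

  _⊆P_ : Pair {Fml} → Pair {Fml} → Set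
  (ΓA , ΓR) ⊆P (ΓA′ , ΓR′) = (ΓA ⊆ ΓA′) × (ΓR ⊆ ΓR′)

  ⊆P-refl : ∀ {F} → F ⊆P F
  ⊆P-refl = ⊆-refl , ⊆-refl

  ≈P-refl : ∀ {F : Pair {Fml}} → F ≈P F
  ≈P-refl = (⊆-refl , ⊆-refl) , (⊆-refl , ⊆-refl)

  ≈P⇒⊆P : ∀ {F G} → F ≈P G → F ⊆P G
  ≈P⇒⊆P ((ΓA⊆ , _) , (ΓR⊆ , _)) = ΓA⊆ , ΓR⊆

  ⊆P-extend : ∀ F c → F ⊆P extend F c
  ⊆P-extend F (sA , ψ) = xs⊆x∷xs _ ψ , ⊆-refl
  ⊆P-extend F (sR , ψ) = ⊆-refl , xs⊆x∷xs _ ψ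

  extend-mono : ∀ {F G} c → F ⊆P G → extend F c ⊆P extend G c
  extend-mono (sA , ψ) (ΓA⊆ , ΓR⊆) = ∷⁺ʳ ψ ΓA⊆ , ΓR⊆
  extend-mono (sR , ψ) (ΓA⊆ , ΓR⊆) = ΓA⊆ , ∷⁺ʳ ψ ΓR⊆

  LabelClosed-mono : ∀ {C : Cond {Fml}} {F G} → F ⊆P G → LabelClosed C F → LabelClosed C G
  LabelClosed-mono (ΓA⊆ , _) (inj₁ p) = inj₁ (Any-resp-⊆ ΓA⊆ p)
  LabelClosed-mono (_ , ΓR⊆) (inj₂ p) = inj₂ (Any-resp-⊆ ΓR⊆ p)

  Applicable-mono : ∀ r {F G} → F ⊆P G → Applicable r F → Applicable r G
  Applicable-mono _ (ΓA⊆ , ΓR⊆) (ΔA⊆ , ΔR⊆) = ΓA⊆ ∘ ΔA⊆ , ΓR⊆ ∘ ΔR⊆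

  Present : Pair {Fml} → Child {Fml} → Set
  Present (ΓA , _) (sA , ψ) = ψ ∈ ΓA
  Present (_ , ΓR) (sR , ψ) = ψ ∈ ΓR

  Present-mono : ∀ {F G} c → F ⊆P G → Present F c → Present G c
  Present-mono (sA , _) (ΓA⊆ , _) p = ΓA⊆ p
  Present-mono (sR , _) (_ , ΓR⊆) p = ΓR⊆ p

  present-extend : ∀ F c → Present (extend F c) c
  present-extend F (sA , _) = here refl
  present-extend F (sR , _) = here refl

  extend-⊆P : ∀ {F G} c → F ⊆P G → Present G c → extend F c ⊆P G
  extend-⊆P (sA , _) (ΓA⊆ , ΓR⊆) p = ∈-∷⁺ʳ p ΓA⊆ , ΓR⊆
  extend-⊆P (sR , _) (ΓA⊆ , ΓR⊆) p = ΓA⊆ , ∈-∷⁺ʳ p ΓR⊆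

  AllClosed⇒All : ∀ {C : Cond {Fml}} ts → AllClosed C ts → All (Closed C) ts
  AllClosed⇒All []       _          = []
  AllClosed⇒All (t ∷ ts) (cl , cls) = cl ∷ AllClosed⇒All ts cls

  All⇒AllClosed : ∀ {C : Cond {Fml}} {ts} → All (Closed C) ts → AllClosed C ts
  All⇒AllClosed []         = tt
  All⇒AllClosed (cl ∷ cls) = cl , All⇒AllClosed cls

  node-closed⇒All : ∀ {C : Cond {Fml}} {F} ts → Closed C (node F ts) → All (Closed C) ts
  node-closed⇒All []       _  = []
  node-closed⇒All (t ∷ ts) cl = AllClosed⇒All (t ∷ ts) cl

  data Closable (C : Cond {Fml}) {n : ℕ} (R : Vec (Rule {Fml}) n) : Pair {Fml} → Set where
    done  : ∀ {F} → LabelClosed C F → Closable C R F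
    apply : ∀ {F} r → r ∈ᵥ R → Applicable r F →
            (∀ {c} → c ∈ children r → Closable C R (extend F c)) → Closable C R F

  Closable-mono : ∀ {C n} {R : Vec Rule n} {F G} → F ⊆P G → Closable C R F → Closable C R G
  Closable-mono F⊆G (done lc)          = done (LabelClosed-mono F⊆G lc)
  Closable-mono F⊆G (apply r r∈ app f) =
    apply r r∈ (Applicable-mono r F⊆G app)
      (λ {c} c∈ → Closable-mono (extend-mono c F⊆G) (f c∈))

  Closable-⊆R : ∀ {C m n} {R : Vec Rule m} {R′ : Vec Rule n} →
                (∀ {r} → r ∈ᵥ R → r ∈ᵥ R′) → ∀ {F} → Closable C R F → Closable C R′ F
  Closable-⊆R R⊆R′ (done lc)          = done lc
  Closable-⊆R R⊆R′ (apply r r∈ app f) = apply r (R⊆R′ r∈) app (Closable-⊆R R⊆R′ ∘ f)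

  Closable-removeAt : ∀ {C n} (R : Vec Rule (suc n)) i {c} → c ∈ children (lookup R i) →
                      ∀ {G} → Closable C R G → Present G c → Closable C (removeAt R i) G
  Closable-removeAt R i c∈ (done lc) _ = done lc
  Closable-removeAt R i {c} c∈ {G} (apply r r∈ app f) p with i ≟ᶠ VecAny.index r∈
  ... | yes refl =
    Closable-mono (extend-⊆P c ⊆P-refl p)
      (Closable-removeAt R i c∈ (f (subst (λ r → c ∈ children r) (sym (lookup-index r∈)) c∈))
                         (present-extend G c))
  ... | no i≢ =
    apply r (∈-removeAt⁺ r∈ i≢) app
      (λ {d} d∈ → Closable-removeAt R i c∈ (f d∈) (Present-mono c (⊆P-extend G d) p))

  module _ (C : Cond {Fml}) {n : ℕ} (R : Vec (Rule {Fml}) n) where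

    mutual
      Deriv⇒Closable : ∀ {F ts} → Deriv R (node F ts) → Closed C (node F ts) → Closable C R F
      Deriv⇒Closable (leaf F) lc = done lc
      Deriv⇒Closable (axiom F r r∈ app none) _ =
        apply r r∈ app (λ c∈ → ⊥-elim (¬Any[] (subst (_ ∈_) none c∈)))
      Deriv⇒Closable (step F r ts r∈ app _ covering ds) cl = apply r r∈ app λ c∈ →
        let t , t∈ , label = covering c∈ in
        All.lookup (children⇒Closable ds) t∈ (All.lookup (node-closed⇒All ts cl) t∈) label

      children⇒Closable : ∀ {ts} → All (Deriv R) ts →
                          All (λ t → Closed C t → ∀ {G} → HasLabel t G → Closable C R G) ts
      children⇒Closable []       = []
      children⇒Closable (d ∷ ds) = labelled⇒Closable d ∷ children⇒Closable ds

      labelled⇒Closable : ∀ {t} → Deriv R t → Closed C t →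
                          ∀ {G} → HasLabel t G → Closable C R G
      labelled⇒Closable {node _ _} d cl label =
        Closable-mono (≈P⇒⊆P label) (Deriv⇒Closable d cl)

    ClosedDerivation : Pair → Set
    ClosedDerivation F = Σ[ T ∈ Tree ] (Deriv R T × HasLabel T F × Closed C T)

    record Forest (F : Pair) (cs : List Child) : Set where
      field
        trees     : List Tree
        derivs    : All (Deriv R) trees
        allClosed : AllClosed C trees
        labelled  : ∀ {t} → t ∈ trees → Σ[ c ∈ Child ] (c ∈ cs × HasLabel t (extend F c))
        covering  : ∀ {c} → c ∈ cs → Σ[ t ∈ Tree ] (t ∈ trees × HasLabel t (extend F c))
        nonempty  : trees ≡ [] → cs ≡ []

    forest : ∀ F cs → (∀ {c} → c ∈ cs → ClosedDerivation (extend F c)) → Forest F cs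
    forest F [] _ = record
      { trees = [] ; derivs = [] ; allClosed = tt
      ; labelled = λ () ; covering = λ () ; nonempty = λ _ → refl }
    forest F (c ∷ cs) g with g (here refl) | forest F cs (g ∘ there)
    ... | t , d , label , cl | rest = record
      { trees     = t ∷ trees
      ; derivs    = d ∷ derivs
      ; allClosed = cl , allClosed
      ; labelled  = λ { (here refl) → c , here refl , label
                      ; (there t∈) → map₂ (map₁ there) (labelled t∈) }
      ; covering  = λ { (here refl) → t , here refl , label
                      ; (there c∈) → map₂ (map₁ there) (covering c∈) }
      ; nonempty  = λ () }
      where open Forest rest

    Closable⇒Deriv : ∀ {F} → Closable C R F → ClosedDerivation F
    Closable⇒Deriv {F} (done lc) = node F [] , leaf F , ≈P-refl , lc
    Closable⇒Deriv {F} (apply r r∈ app f) with forest F (children r) (Closable⇒Deriv ∘ f)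
    ... | record { trees = [] ; nonempty = nonempty } =
      node F (star ∷ []) , axiom F r r∈ app (nonempty refl) , ≈P-refl , tt , tt
    ... | record { trees = t ∷ ts ; derivs = ds ; allClosed = cl ; labelled = lab ; covering = cov } =
      node F (t ∷ ts) , step F r (t ∷ ts) r∈ app lab cov ds , ≈P-refl , cl

  Provable⇔Closable : ∀ {n} (R : Vec Rule n) Φ →
                      Provable R Φ ⇔ Closable (cond Φ) R (rootPair Φ)
  Provable⇔Closable R Φ = mk⇔ to from
    where
      to : Provable R Φ → Closable (cond Φ) R (rootPair Φ)
      to (node F ts , d , below , cl) = Closable-mono below (Deriv⇒Closable (cond Φ) R d cl)

      from : Closable (cond Φ) R (rootPair Φ) → Provable R Φ
      from closable with Closable⇒Deriv (cond Φ) R closable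
      ... | node (ΓA , ΓR) ts , d , label , cl = node (ΓA , ΓR) ts , d , ≈P⇒⊆P label , cl

module Expansion {Fml : Set} (_≟_ : DecidableEquality Fml) (S : Schedule {Fml}) (C : Cond {Fml}) where
  open DecMembership _≟_ using (_∈?_)
  open Run _≟_ S C
  open Schedule S

  ¬All∉⇒Any∈ : ∀ Γ ψs → ¬ All (_∉ Γ) ψs → Any (_∈ Γ) ψs
  ¬All∉⇒Any∈ Γ ψs ¬fresh =
    Any.map (decidable-stable (_ ∈? Γ)) (¬All⇒Any¬ (λ ψ → ¬? (ψ ∈? Γ)) ψs ¬fresh)

  ¬Usable⇒present-child : ∀ r F → Applicable r F → ¬ Usable _≟_ r F →
                          Any (Present F) (children r)
  ¬Usable⇒present-child r (ΓA , ΓR) (ΔA⊆ , ΔR⊆) ¬usable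
    with All.all? (λ ψ → ¬? (ψ ∈? ΓA)) (sucA r)
  ... | no ¬freshA = ++⁺ˡ (Anyₚ.map⁺ (¬All∉⇒Any∈ ΓA (sucA r) ¬freshA))
  ... | yes freshA = ++⁺ʳ (map (sA ,_) (sucA r)) (Anyₚ.map⁺ (¬All∉⇒Any∈ ΓR (sucR r)
                       λ freshR → ¬usable (ΔA⊆ , ΔR⊆ , freshA , freshR)))

  usable-rule : ∀ {n} {R : Vec Rule n} {G F} → Closable C R G → G ⊆P F → ¬ LabelClosed C F →
                Σ[ j ∈ Fin n ] Usable _≟_ (lookup R j) F
  usable-rule (done lc) G⊆F ¬lc = ⊥-elim (¬lc (LabelClosed-mono G⊆F lc))
  usable-rule {F = F} (apply r r∈ app f) G⊆F ¬lc with usable? _≟_ r F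
  ... | yes usable = VecAny.index r∈ , subst (λ r → Usable _≟_ r F) (lookup-index r∈) usable
  ... | no ¬usable with find (¬Usable⇒present-child r F (Applicable-mono r G⊆F app) ¬usable)
  ... | c , c∈ , p = usable-rule (f c∈) (extend-⊆P c G⊆F p) ¬lc

  ClosedChild : (Pair {Fml} → Tree {Fml}) → Pair {Fml} → Child {Fml} → Set
  ClosedChild sub F c = Closed C (sub (extend F c))

  loopChildren-inj₁ : ∀ sub F cs acc {T} → loopChildren sub F cs acc ≡ inj₁ T →
                      ¬ Closed C T × ¬ All (ClosedChild sub F) cs
  loopChildren-inj₁ sub F (c ∷ cs) acc eq with closed? _≟_ C (sub (extend F c))
  loopChildren-inj₁ sub F (c ∷ cs) acc refl | no ¬cl =
    (λ cl → ¬cl (All.head (++⁻ʳ acc (node-closed⇒All (acc ++ _ ∷ []) cl))))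
    , λ { (cl ∷ _) → ¬cl cl }
  ... | yes cl = map₂ (λ ¬all → ¬all ∘ All.tail) (loopChildren-inj₁ sub F cs _ eq)

  loopChildren-inj₂ : ∀ sub F cs acc {acc′} → loopChildren sub F cs acc ≡ inj₂ acc′ →
                      All (ClosedChild sub F) cs × acc′ ≡ acc ++ map (sub ∘ extend F) cs
  loopChildren-inj₂ sub F [] acc refl = [] , sym (++-identityʳ acc)
  loopChildren-inj₂ sub F (c ∷ cs) acc eq with closed? _≟_ C (sub (extend F c))
  loopChildren-inj₂ sub F (c ∷ cs) acc () | no _
  ... | yes cl with loopChildren-inj₂ sub F cs (acc ++ sub (extend F c) ∷ []) eq
  ... | cls , acc′≡ = cl ∷ cls , trans acc′≡ (++-assoc acc _ (map (sub ∘ extend F) cs))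

  -- Expand starts each pair with no children, so step (3c) always returns
  -- after the first usable rule whose branches all close.
  loopChildren-inj₂-closed : ∀ sub F c cs {acc′} →
                             loopChildren sub F (c ∷ cs) [] ≡ inj₂ acc′ →
                             Closed C (node F acc′)
  loopChildren-inj₂-closed sub F c cs eq with loopChildren-inj₂ sub F (c ∷ cs) [] eq
  ... | cls , refl = All⇒AllClosed (Allₚ.map⁺ cls)

  loopRules-sound : ∀ {n} (R : Vec Rule n) sub F →
                    (∀ i G → Closed C (sub i G) → Closable C R G) →
                    ∀ is → Closed C (loopRules sub R F is []) → Closable C R F
  loopRules-sound R sub F sub-sound [] cl = done cl
  loopRules-sound R sub F sub-sound (i ∷ is) cl with usable? _≟_ (lookup R i) F
  ... | no _ = loopRules-sound R sub F sub-sound is cl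
  ... | yes (ΔA⊆ , ΔR⊆ , _) with childOrder F (lookup R i) | childOrder-perm F (lookup R i)
  ...   | [] | order↭ =
    apply (lookup R i) (∈-lookup i R) (ΔA⊆ , ΔR⊆) (⊥-elim ∘ ¬Any[] ∘ ∈-resp-↭ (↭-sym order↭))
  ...   | c ∷ cs | order↭ with loopChildren (sub i) F (c ∷ cs) [] in eq
  ...     | inj₁ _ = ⊥-elim (proj₁ (loopChildren-inj₁ (sub i) F (c ∷ cs) [] eq) cl)
  ...     | inj₂ acc′ with closed? _≟_ C (node F acc′)
  ...       | no ¬cl = ⊥-elim (¬cl (loopChildren-inj₂-closed (sub i) F c cs eq))
  ...       | yes _ =
    apply (lookup R i) (∈-lookup i R) (ΔA⊆ , ΔR⊆) λ c∈ →
      let branches-closed = proj₁ (loopChildren-inj₂ (sub i) F (c ∷ cs) [] eq) in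
      sub-sound i _ (All.lookup (All-resp-↭ order↭ branches-closed) c∈)

  expandWith-sound : ∀ {n} (R : Vec Rule n) sub F →
                     (∀ i G → Closed C (sub i G) → Closable C R G) →
                     Closed C (expandWith sub R F) → Closable C R F
  expandWith-sound R sub F sub-sound cl with labelClosed? _≟_ C F
  ... | yes lc = done lc
  ... | no _   = loopRules-sound R sub F sub-sound (ruleOrder F R) cl

  expand-sound : ∀ n (R : Vec Rule n) F → Closed C (expand n R F) → Closable C R F
  expand-sound zero    R F = expandWith-sound R _ F (λ ())
  expand-sound (suc m) R F = expandWith-sound R _ F λ i G cl →
    Closable-⊆R (∈-removeAt⁻ R i) (expand-sound m (removeAt R i) G cl)

  loopRules-complete : ∀ {n} (R : Vec Rule n) sub F → Closable C R F → ¬ LabelClosed C F →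
                       (∀ i {c} → c ∈ children (lookup R i) → Closed C (sub i (extend F c))) →
                       ∀ is → (∀ j → Usable _≟_ (lookup R j) F → j ∈ is) →
                       Closed C (loopRules sub R F is [])
  loopRules-complete R sub F closable ¬lc sub-complete [] pending
    with usable-rule closable ⊆P-refl ¬lc
  ... | j , usable = ⊥-elim (¬Any[] (pending j usable))
  loopRules-complete R sub F closable ¬lc sub-complete (i ∷ is) pending
    with usable? _≟_ (lookup R i) F
  ... | no ¬usable = loopRules-complete R sub F closable ¬lc sub-complete is pending′
    where
      pending′ : ∀ j → Usable _≟_ (lookup R j) F → j ∈ is
      pending′ j usable with pending j usable
      ... | here refl = ⊥-elim (¬usable usable)
      ... | there j∈  = j∈
  ... | yes _ with childOrder F (lookup R i) | childOrder-perm F (lookup R i)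
  ...   | [] | _ = tt , tt
  ...   | c ∷ cs | order↭ with loopChildren (sub i) F (c ∷ cs) [] in eq
  ...     | inj₁ _ = ⊥-elim (proj₂ (loopChildren-inj₁ (sub i) F (c ∷ cs) [] eq)
                               (All-resp-↭ (↭-sym order↭) (All.tabulate (sub-complete i))))
  ...     | inj₂ acc′ with closed? _≟_ C (node F acc′)
  ...       | yes cl  = cl
  ...       | no ¬cl  = ⊥-elim (¬cl (loopChildren-inj₂-closed (sub i) F c cs eq))

  expandWith-complete : ∀ {n} (R : Vec Rule n) sub F → Closable C R F →
                        (∀ i {c} → c ∈ children (lookup R i) → Closed C (sub i (extend F c))) →
                        Closed C (expandWith sub R F)
  expandWith-complete R sub F closable sub-complete with labelClosed? _≟_ C F
  ... | yes lc  = lc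
  ... | no ¬lc  = loopRules-complete R sub F closable ¬lc sub-complete (ruleOrder F R)
                    (λ j _ → ∈-resp-↭ (↭-sym (ruleOrder-perm F R)) (∈-allFin j))

  expand-complete : ∀ n (R : Vec Rule n) F → Closable C R F → Closed C (expand n R F)
  expand-complete zero    R F closable = expandWith-complete R _ F closable (λ ())
  expand-complete (suc m) R F closable = expandWith-complete R _ F closable λ i {c} c∈ →
    expand-complete m (removeAt R i) (extend F c)
      (Closable-removeAt R i c∈ (Closable-mono (⊆P-extend F c) closable) (present-extend F c))

lemma3 : {Fml : Set} (_≟_ : DecidableEquality Fml)
    (n : ℕ) (R : Vec (Rule {Fml}) n) →
    (∀ (i j : Fin n) → SameRule (lookup R i) (lookup R j) → i ≡ j) →
    (Φ : BSequent {Fml}) (S : Schedule {Fml}) →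
    Closed (cond Φ) (Expand _≟_ S R Φ) ⇔ Provable R Φ
lemma3 _≟_ n R _ Φ S =
  mk⇔ (from ∘ expand-sound n R (rootPair Φ)) (expand-complete n R (rootPair Φ) ∘ to)
  where
    open Expansion _≟_ S (cond Φ)
    open Equivalence (Provable⇔Closable R Φ)
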